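{- Let $0<m<n$ and $r_m=s_{ -m}s_{ -m+1}\cdots s_{ -1}\,s_{n-m-1}s_{n-m-2}\cdots s_1s_0\in\widetilde S_n$. If $v\in\widetilde S_n$ is such that $vr_m$ is 321-avoiding and $\ell(vr_m)=\ell(v)+\ell(r_m)$, then $v$ is $0$-Grassmannian.
   Context: $\widetilde S_n$ is the affine symmetric group with generators $s_i$, $i\in\mathbb Z/n\mathbb Z$ (indices mod $n$), relations $s_i^2=1$, $s_is_{i+1}s_i=s_{i+1}s_is_{i+1}$, $s_is_j=s_js_i$ for $i-j\ne\pm1$; $\ell$ is the length. An element is $0$-Grassmannian if every nonempty reduced word of it ends with $s_0$ (the identity is $0$-Grassmannian). An element is 321-avoiding if none of its reduced words contains a consecutive factor $s_is_{i+1}s_i$. -}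

module Defs where

open import Data.Nat using (ℕ; zero; suc; _+_; _∸_; _≤_; NonZero)
open import Data.Nat.DivMod using (_mod_)
open import Data.Fin using (Fin; toℕ)
open import Data.List using (List; []; _∷_; _++_; [_]; length; map; upTo; reverse)
open import Data.Product using (Σ; ∃; _×_; _,_)
open import Relation.Binary.PropositionalEquality using (_≡_; _≢_)
open import Relation.Nullary using (¬_)

-- Affine symmetric group S̃_n, presented by generators s_i (i ∈ ℤ/nℤ,
-- represented as Fin n) and the Coxeter relations of the context.
-- An element is a word in the generators, up to the congruence ≈ generated
-- by the defining relations (i.e. the group given by the presentation).
module _ (n : ℕ) .{{_ : NonZero n}} where

  Word : Set
  Word = List (Fin n)

  gen : ℕ → Fin n
  gen k = k mod n

  nxt : Fin n → Fin n
  nxt i = gen (suc (toℕ i))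

  infix 4 _≈_
  data _≈_ : Word → Word → Set where
    ≈-refl  : ∀ {u} → u ≈ u
    ≈-sym   : ∀ {u v} → u ≈ v → v ≈ u
    ≈-trans : ∀ {u v w} → u ≈ v → v ≈ w → u ≈ w
    ≈-++    : ∀ {u u′ v v′} → u ≈ u′ → v ≈ v′ → u ++ v ≈ u′ ++ v′
    rel-sq    : ∀ i → i ∷ i ∷ [] ≈ []
    rel-braid : ∀ i → i ∷ nxt i ∷ i ∷ [] ≈ nxt i ∷ i ∷ nxt i ∷ []
    rel-comm  : ∀ i j → j ≢ nxt i → i ≢ nxt j → i ∷ j ∷ [] ≈ j ∷ i ∷ []

  IsReduced : Word → Word → Set
  IsReduced u w = (u ≈ w) × (∀ u′ → u′ ≈ w → length u ≤ length u′)

  HasLength : Word → ℕ → Set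
  HasLength w k = Σ Word (λ u → IsReduced u w × length u ≡ k)

  ZeroGrassmannian : Word → Set
  ZeroGrassmannian w = ∀ u → IsReduced u w → u ≢ [] →
                       ∃ λ u′ → u ≡ u′ ++ [ gen 0 ]

  Avoids321 : Word → Set
  Avoids321 w = ∀ u → IsReduced u w →
                ¬ (∃ λ p → ∃ λ q → ∃ λ i → u ≡ p ++ (i ∷ nxt i ∷ i ∷ []) ++ q)

  -- r_m = s_{-m} s_{-m+1} ⋯ s_{-1} s_{n-m-1} s_{n-m-2} ⋯ s_1 s_0
  r : ℕ → Word
  r m = map (λ k → gen (n ∸ m + k)) (upTo m) ++ map gen (reverse (upTo (n ∸ m)))

module Submission where

-- Let c = n - m, so that r_m = s_c s_{c+1} ⋯ s_{n-1} · s_{c-1} ⋯ s_1 s_0.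
-- Suppose a reduced word u′ s_j of v ends in some s_j ≠ s_0.  We show that
-- s_j r_m equals either a word of length n + 1 containing a factor
-- s_i s_{i+1} s_i (when j ≠ c: s_j commutes along r_m until a braid appears)
-- or a word with fewer than n letters (j = c: s_c s_c cancels).  Since
-- ℓ(r_m) = n, prefixing u′ gives, in the first case, a reduced word of v r_m
-- with a 321 factor, and in the second a word for v r_m shorter than
-- ℓ(v) + ℓ(r_m) = ℓ(v r_m); both are impossible.
--
-- The equality ℓ(r_m) = n is the substantial part: every word for r_m uses
-- all n generators.  To see that s_k occurs, let words act on ℤ/2nℤ by affine
-- permutations (on three points when n = 2); the generators other than s_k
-- preserve the window (k, k + n], which r_m does not.

open import Defs
open import Data.Nat using (ℕ; zero; suc; _+_; _<_; _≤_; _∸_; NonZero; z≤n; s≤s)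
open import Data.Nat.Base using (>-nonZero⁻¹; pred)
open import Data.Nat.Properties as ℕ using (≤-refl; ≤-trans; <⇒≤; <-irrefl; ≤∧≢⇒<)
open import Data.Nat.DivMod using (m<n⇒m%n≡m; n%n≡0)
open import Data.Fin as F using (Fin; toℕ)
open import Data.Fin.Properties using (toℕ-injective; toℕ<n; toℕ-fromℕ<; injective⇒≤)
open import Data.List using (List; []; _∷_; initLast; _∷ʳ′_; _++_; [_]; length; map; applyUpTo; applyDownFrom)
open import Data.List.Properties using (reverse-upTo; length-++; ++-assoc; map-upTo; map-applyDownFrom; length-applyDownFrom)
open import Data.Bool using (Bool; true; false; not; _xor_)
open import Data.Bool.Properties using (not-involutive)
open import Relation.Nullary.Decidable using (does; dec-true; dec-false)
open import Data.Product using (Σ; ∃; _×_; _,_; proj₁; proj₂)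
open import Data.Sum using (_⊎_; inj₁; inj₂)
open import Data.Empty using (⊥; ⊥-elim)
open import Data.List.Relation.Unary.All using (All; []; _∷_)
open import Relation.Binary.PropositionalEquality hiding ([_])
open import Relation.Nullary using (¬_; Dec; yes; no)
open import Relation.Binary.Definitions using (Tri; tri<; tri≈; tri>)
open import Data.List using (lookup)
open import Data.List.Relation.Unary.Any using (here; there; index)
open import Data.List.Relation.Unary.Any.Properties using (lookup-index)
open import Data.List.Membership.Propositional using (_∈_)
open import Function using (id; _∘_; _∘′_)

module Indices (n : ℕ) .{{_ : NonZero n}} where

  0<n : 0 < n
  0<n = >-nonZero⁻¹ n

  toℕ-gen : ∀ {x} → x < n → toℕ (gen n x) ≡ x
  toℕ-gen x<n = trans (toℕ-fromℕ< _) (m<n⇒m%n≡m x<n)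

  gen-injective : ∀ {x y} → x < n → y < n → gen n x ≡ gen n y → x ≡ y
  gen-injective x<n y<n e = trans (sym (toℕ-gen x<n)) (trans (cong toℕ e) (toℕ-gen y<n))

  gen-toℕ : ∀ i → gen n (toℕ i) ≡ i
  gen-toℕ i = toℕ-injective (toℕ-gen (toℕ<n i))

  toℕ≡0 : ∀ {i} → toℕ i ≡ 0 → i ≡ gen n 0
  toℕ≡0 i≡0 = toℕ-injective (trans i≡0 (sym (toℕ-gen 0<n)))

  gen-n : gen n n ≡ gen n 0
  gen-n = toℕ-injective (trans (toℕ-fromℕ< _) (trans (n%n≡0 n) (sym (toℕ-gen 0<n))))

  nxt-gen : ∀ {x} → x < n → nxt n (gen n x) ≡ gen n (suc x)
  nxt-gen x<n = cong (λ y → gen n (suc y)) (toℕ-gen x<n)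

  nxt-gen-last : ∀ {x} → suc x ≡ n → nxt n (gen n x) ≡ gen n 0
  nxt-gen-last {x} e = trans (nxt-gen (subst (x <_) e ≤-refl)) (trans (cong (gen n) e) gen-n)

  data NxtView (i : Fin n) : Set where
    inner : suc (toℕ i) < n → toℕ (nxt n i) ≡ suc (toℕ i) → NxtView i
    wraps : suc (toℕ i) ≡ n → toℕ (nxt n i) ≡ 0 → NxtView i

  nxt-view : ∀ i → NxtView i
  nxt-view i with ℕ.m≤n⇒m<n∨m≡n (toℕ<n i)
  ... | inj₁ lt = inner lt (toℕ-gen lt)
  ... | inj₂ eq = wraps eq (trans (cong toℕ (trans (cong (gen n) eq) gen-n)) (toℕ-gen 0<n))

  nxt-injective : ∀ {i j} → nxt n i ≡ nxt n j → i ≡ j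
  nxt-injective {i} {j} e with nxt-view i | nxt-view j
  ... | inner _ a | inner _ b = toℕ-injective (ℕ.suc-injective (trans (sym a) (trans (cong toℕ e) b)))
  ... | inner _ a | wraps _ b with () ← trans (sym a) (trans (cong toℕ e) b)
  ... | wraps _ a | inner _ b with () ← trans (sym a) (trans (cong toℕ e) b)
  ... | wraps p _ | wraps q _ = toℕ-injective (ℕ.suc-injective (trans p (sym q)))

  nxt-irreflexive : 2 ≤ n → ∀ i → nxt n i ≢ i
  nxt-irreflexive 2≤n i e with nxt-view i
  ... | inner _ a = ℕ.1+n≢n (trans (sym a) (cong toℕ e))
  ... | wraps p a = <-irrefl (trans (cong suc (trans (sym a) (cong toℕ e))) p) 2≤n

  nxt²-irreflexive : 3 ≤ n → ∀ i → nxt n (nxt n i) ≢ i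
  nxt²-irreflexive 3≤n i e with nxt-view i | nxt-view (nxt n i)
  ... | inner _ a | inner _ b = 2+k≢k (trans (sym (trans b (cong suc a))) (cong toℕ e))
    where
      2+k≢k : ∀ {k} → suc (suc k) ≢ k
      2+k≢k {suc k} = 2+k≢k ∘′ ℕ.suc-injective
  ... | inner _ a | wraps q b = <-irrefl (trans (cong suc (trans (cong suc (sym i≡0)) (sym a))) q) 3≤n
    where
      i≡0 : toℕ i ≡ 0
      i≡0 = trans (sym (cong toℕ e)) b
  ... | wraps p a | inner _ b = <-irrefl (trans (cong suc (sym i≡1)) p) 3≤n
    where
      i≡1 : toℕ i ≡ 1
      i≡1 = trans (sym (cong toℕ e)) (trans b (cong suc a))
  ... | wraps _ a | wraps q b = <-irrefl (trans (cong suc (sym a)) q) (≤-trans (s≤s (s≤s z≤n)) 3≤n)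

  private
    nxt-surjective : ∀ c → Σ (Fin n) λ p → nxt n p ≡ c
    nxt-surjective c with toℕ c in e
    ... | zero = gen n (pred n) , trans (nxt-gen-last (ℕ.suc-pred n)) c≡gen0
      where
        c≡gen0 : gen n 0 ≡ c
        c≡gen0 = trans (cong (gen n) (sym e)) (gen-toℕ c)
    ... | suc t = gen n t , trans (nxt-gen t<n) (trans (cong (gen n) (sym e)) (gen-toℕ c))
      where
        t<n : t < n
        t<n = ℕ.<-trans ℕ.≤-refl (subst (_< n) e (toℕ<n c))

  prv : Fin n → Fin n
  prv c = proj₁ (nxt-surjective c)

  nxt-prv : ∀ c → nxt n (prv c) ≡ c
  nxt-prv c = proj₂ (nxt-surjective c)

  prv-nxt : ∀ c → prv (nxt n c) ≡ c
  prv-nxt c = nxt-injective (nxt-prv (nxt n c))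

  Away : Fin n → Fin n → Set
  Away i c = (c ≢ i) × (c ≢ nxt n i)

  away-gen : ∀ {i x} → i < n → x < n → x ≢ i → (suc i < n → x ≢ suc i) → (suc i ≡ n → x ≢ 0) →
             Away (gen n i) (gen n x)
  away-gen {i} {x} i<n x<n x≢i x≢i+1 x≢0 = x≢i ∘ gen-injective x<n i<n , x≢nxt
    where
      x≢nxt : gen n x ≢ nxt n (gen n i)
      x≢nxt e with ℕ.m≤n⇒m<n∨m≡n i<n
      ... | inj₁ lt = x≢i+1 lt (gen-injective x<n lt (trans e (nxt-gen i<n)))
      ... | inj₂ eq = x≢0 eq (gen-injective x<n 0<n (trans e (nxt-gen-last eq)))

  Commuting : Fin n → Fin n → Set
  Commuting i j = (j ≢ nxt n i) × (i ≢ nxt n j)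

  commuting-gen : ∀ {x y} → suc (suc x) ≤ y → y < n → (suc y < n ⊎ 1 ≤ x) → Commuting (gen n x) (gen n y)
  commuting-gen {x} {y} x+2≤y y<n side = y≢x+1 , x≢y+1
    where
      x+1<n : suc x < n
      x+1<n = ℕ.<-trans x+2≤y y<n
      y≢x+1 : gen n y ≢ nxt n (gen n x)
      y≢x+1 e = <-irrefl (sym (gen-injective y<n x+1<n (trans e (nxt-gen (<⇒≤ x+1<n))))) x+2≤y
      x≢y+1 : gen n x ≢ nxt n (gen n y)
      x≢y+1 e with ℕ.m≤n⇒m<n∨m≡n y<n
      ... | inj₁ y+1<n = <-irrefl (gen-injective (<⇒≤ x+1<n) y+1<n (trans e (nxt-gen y<n)))
                                  (ℕ.<-trans (ℕ.n<1+n x) (≤-trans x+2≤y (ℕ.n≤1+n y)))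
      ... | inj₂ y+1≡n = not-last side
        where
          not-last : ¬ (suc y < n ⊎ 1 ≤ x)
          not-last (inj₁ y+1<n) = <-irrefl y+1≡n y+1<n
          not-last (inj₂ 1≤x)   = <-irrefl (sym (gen-injective (<⇒≤ x+1<n) 0<n (trans e (nxt-gen-last y+1≡n)))) 1≤x

module Runs (n : ℕ) .{{_ : NonZero n}} where

  ascent : ℕ → ℕ → Word n
  ascent c zero    = []
  ascent c (suc m) = gen n c ∷ ascent (suc c) m

  descent : ℕ → Word n
  descent = applyDownFrom (gen n)

  length-ascent : ∀ c m → length (ascent c m) ≡ m
  length-ascent c zero    = refl
  length-ascent c (suc m) = cong suc (length-ascent (suc c) m)

  length-descent : ∀ t → length (descent t) ≡ t
  length-descent = length-applyDownFrom (gen n)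

  All-ascent : ∀ {P : Fin n → Set} c m → (∀ j → c ≤ j → j < c + m → P (gen n j)) → All P (ascent c m)
  All-ascent c zero    h = []
  All-ascent c (suc m) h =
    h c ≤-refl (subst (c <_) (sym (ℕ.+-suc c m)) (s≤s (ℕ.m≤m+n c m))) ∷
    All-ascent (suc c) m (λ j c<j j<e → h j (<⇒≤ c<j) (subst (j <_) (sym (ℕ.+-suc c m)) j<e))

  All-descent : ∀ {P : Fin n → Set} t → (∀ j → j < t → P (gen n j)) → All P (descent t)
  All-descent zero    h = []
  All-descent (suc t) h = h t ≤-refl ∷ All-descent t (λ j j<t → h j (ℕ.m≤n⇒m≤1+n j<t))

  private
    applyUpTo-ascent : ∀ c m (f : ℕ → Fin n) → (∀ k → f k ≡ gen n (c + k)) → applyUpTo f m ≡ ascent c m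
    applyUpTo-ascent c zero    f h = refl
    applyUpTo-ascent c (suc m) f h =
      cong₂ _∷_ (trans (h 0) (cong (gen n) (ℕ.+-identityʳ c)))
                (applyUpTo-ascent (suc c) m (f ∘ suc) (λ k → trans (h (suc k)) (cong (gen n) (ℕ.+-suc c k))))

  r-split : ∀ m → r n m ≡ ascent (n ∸ m) m ++ descent (n ∸ m)
  r-split m = cong₂ _++_
    (trans (map-upTo (λ k → gen n (n ∸ m + k)) m) (applyUpTo-ascent (n ∸ m) m _ (λ k → refl)))
    (trans (cong (map (gen n)) (reverse-upTo (n ∸ m))) (map-applyDownFrom id (gen n) (n ∸ m)))

  length-r : ∀ {m} → m ≤ n → length (r n m) ≡ n
  length-r {m} m≤n = begin
    length (r n m)                                  ≡⟨ cong length (r-split m) ⟩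
    length (ascent (n ∸ m) m ++ descent (n ∸ m))    ≡⟨ length-++ (ascent (n ∸ m) m) ⟩
    length (ascent (n ∸ m) m) + length (descent (n ∸ m)) ≡⟨ cong₂ _+_ (length-ascent (n ∸ m) m) (length-descent (n ∸ m)) ⟩
    m + (n ∸ m)                                     ≡⟨ ℕ.m+[n∸m]≡n m≤n ⟩
    n                                               ∎
    where open ≡-Reasoning

-- This is the only tool used to show that some letter occurs in every word of
-- an element: exhibit an invariant that all other generators preserve.
module Actions (n : ℕ) .{{_ : NonZero n}} where

  record Action : Set₁ where
    field
      Point     : Set
      act       : Fin n → Point → Point
      act-sq    : ∀ i x → act i (act i x) ≡ x
      act-braid : ∀ i x → act i (act (nxt n i) (act i x)) ≡ act (nxt n i) (act i (act (nxt n i) x))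
      act-comm  : ∀ i j → j ≢ nxt n i → i ≢ nxt n j → ∀ x → act i (act j x) ≡ act j (act i x)

  module _ (A : Action) where
    open Action A

    run : Word n → Point → Point
    run []      x = x
    run (i ∷ u) x = act i (run u x)

    run-++ : ∀ u v x → run (u ++ v) x ≡ run u (run v x)
    run-++ []      v x = refl
    run-++ (i ∷ u) v x = cong (act i) (run-++ u v x)

    run-≈ : ∀ {u v} → _≈_ n u v → ∀ x → run u x ≡ run v x
    run-≈ ≈-refl                 x = refl
    run-≈ (≈-sym p)              x = sym (run-≈ p x)
    run-≈ (≈-trans p q)          x = trans (run-≈ p x) (run-≈ q x)
    run-≈ (≈-++ {u} {u′} {v} {v′} p q) x = begin
      run (u ++ v) x    ≡⟨ run-++ u v x ⟩
      run u (run v x)   ≡⟨ cong (run u) (run-≈ q x) ⟩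
      run u (run v′ x)  ≡⟨ run-≈ p (run v′ x) ⟩
      run u′ (run v′ x) ≡⟨ run-++ u′ v′ x ⟨
      run (u′ ++ v′) x  ∎
      where open ≡-Reasoning
    run-≈ (rel-sq i)             x = act-sq i x
    run-≈ (rel-braid i)          x = act-braid i x
    run-≈ (rel-comm i j j≢ i≢)   x = act-comm i j j≢ i≢ x

    run-fixed : ∀ u x → All (λ i → act i x ≡ x) u → run u x ≡ x
    run-fixed []      x []       = refl
    run-fixed (i ∷ u) x (p ∷ ps) = trans (cong (act i) (run-fixed u x ps)) p

    letter-needed : (Inv : Point → Set) (k : Fin n) →
                    (∀ i x → i ≢ k → Inv x → Inv (act i x)) →
                    ∀ {w} x → Inv x → ¬ Inv (run w x) → ∀ u → _≈_ n u w → k ∈ u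
    letter-needed Inv k preserve {w} x inv escapes u u≈w =
      occurs u (λ inv′ → escapes (subst Inv (run-≈ u≈w x) inv′))
      where
        occurs : ∀ u → ¬ Inv (run u x) → k ∈ u
        occurs []      out = ⊥-elim (out inv)
        occurs (i ∷ u) out with i F.≟ k
        ... | yes i≡k = here (sym i≡k)
        ... | no  i≢k = there (occurs u (λ inv′ → out (preserve i (run u x) i≢k inv′)))

covering-length : ∀ {n} (u : List (Fin n)) → (∀ k → k ∈ u) → n ≤ length u
covering-length u mem = injective⇒≤ {f = λ k → index (mem k)} λ {i} {j} e → begin
  i                          ≡⟨ lookup-index (mem i) ⟩
  lookup u (index (mem i))   ≡⟨ cong (lookup u) e ⟩
  lookup u (index (mem j))   ≡⟨ lookup-index (mem j) ⟨
  j                          ∎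
  where open ≡-Reasoning

-- Let X carry a bijection S (inverse P) lying
-- over i ↦ i + 1 along π : X → ℤ/nℤ.  Letting s_i move the fibre over i up
-- by S, the fibre over i + 1 down by P, and fix everything else satisfies the
-- defining relations as soon as n ≥ 3 (the relations are checked fibrewise).
module CyclicCover (n : ℕ) .{{_ : NonZero n}} (3≤n : 3 ≤ n)
                   {X : Set} (π : X → Fin n) (S P : X → X)
                   (π-S : ∀ x → π (S x) ≡ nxt n (π x))
                   (S-P : ∀ x → S (P x) ≡ x) (P-S : ∀ x → P (S x) ≡ x) where
  open Indices n
  open Actions n

  private
    2≤n : 2 ≤ n
    2≤n = <⇒≤ 3≤n

  π-S′ : ∀ {x i} → π x ≡ i → π (S x) ≡ nxt n i
  π-S′ {x} e = trans (π-S x) (cong (nxt n) e)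

  π-P : ∀ {x i} → π x ≡ nxt n i → π (P x) ≡ i
  π-P {x} e = nxt-injective (trans (sym (π-S (P x))) (trans (cong π (S-P x)) e))

  act : Fin n → X → X
  act i x with π x F.≟ i | π x F.≟ nxt n i
  ... | yes _ | _     = S x
  ... | no _  | yes _ = P x
  ... | no _  | no _  = x

  act-up : ∀ {i x} → π x ≡ i → act i x ≡ S x
  act-up {i} {x} e with π x F.≟ i
  ... | yes _ = refl
  ... | no ne = ⊥-elim (ne e)

  act-down : ∀ {i x} → π x ≡ nxt n i → act i x ≡ P x
  act-down {i} {x} e with π x F.≟ i | π x F.≟ nxt n i
  ... | yes e′ | _     = ⊥-elim (nxt-irreflexive 2≤n i (trans (sym e) e′))
  ... | no _  | yes _  = refl
  ... | no _  | no ne  = ⊥-elim (ne e)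

  act-away : ∀ {i x c} → π x ≡ c → Away i c → act i x ≡ x
  act-away {i} {x} refl (ne , ne′) with π x F.≟ i | π x F.≟ nxt n i
  ... | yes e | _     = ⊥-elim (ne e)
  ... | no _  | yes e = ⊥-elim (ne′ e)
  ... | no _  | no _  = refl

  act-S : ∀ {i x} → π x ≡ i → act i (S x) ≡ x
  act-S {x = x} e = trans (act-down (π-S′ e)) (P-S x)

  act-sq : ∀ i x → act i (act i x) ≡ x
  act-sq i x with π x F.≟ i | π x F.≟ nxt n i
  ... | yes e | _     = trans (act-down (π-S′ e)) (P-S x)
  ... | no _  | yes e = trans (act-up (π-P e)) (S-P x)
  ... | no ne | no ne′ = act-away refl (ne , ne′)

  -- The braid relation at a, b = a + 1, e = a + 2: both sides send the fibre
  -- over a up twice, the fibre over e down twice, and fix everything else.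
  act-braid : ∀ a x → act a (act (nxt n a) (act a x)) ≡ act (nxt n a) (act a (act (nxt n a) x))
  act-braid a x = cases (π x F.≟ a) (π x F.≟ b) (π x F.≟ e)
    where
      open ≡-Reasoning
      b e : Fin n
      b = nxt n a
      e = nxt n b
      b≢a : b ≢ a
      b≢a = nxt-irreflexive 2≤n a
      e≢b : e ≢ b
      e≢b = nxt-irreflexive 2≤n b
      e≢a : e ≢ a
      e≢a = nxt²-irreflexive 3≤n a
      cases : Dec (π x ≡ a) → Dec (π x ≡ b) → Dec (π x ≡ e) →
              act a (act b (act a x)) ≡ act b (act a (act b x))
      cases (yes x∈a) _ _ = begin
        act a (act b (act a x)) ≡⟨ cong (act a ∘ act b) (act-up x∈a) ⟩
        act a (act b (S x))     ≡⟨ cong (act a) (act-up (π-S′ x∈a)) ⟩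
        act a (S (S x))         ≡⟨ act-away (π-S′ (π-S′ x∈a)) (e≢a , e≢b) ⟩
        S (S x)                 ≡⟨ act-up (π-S′ x∈a) ⟨
        act b (S x)             ≡⟨ cong (act b) (act-up x∈a) ⟨
        act b (act a x)         ≡⟨ cong (act b ∘ act a) (act-away x∈a (≢-sym b≢a , ≢-sym e≢a)) ⟨
        act b (act a (act b x)) ∎
      cases (no _) (yes x∈b) _ = begin
        act a (act b (act a x)) ≡⟨ cong (act a ∘ act b) (act-down x∈b) ⟩
        act a (act b (P x))     ≡⟨ cong (act a) (act-away (π-P x∈b) (≢-sym b≢a , ≢-sym e≢a)) ⟩
        act a (P x)             ≡⟨ act-up (π-P x∈b) ⟩
        S (P x)                 ≡⟨ S-P x ⟩
        x                       ≡⟨ P-S x ⟨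
        P (S x)                 ≡⟨ act-down (π-S′ x∈b) ⟨
        act b (S x)             ≡⟨ cong (act b) (act-away (π-S′ x∈b) (e≢a , e≢b)) ⟨
        act b (act a (S x))     ≡⟨ cong (act b ∘ act a) (act-up x∈b) ⟨
        act b (act a (act b x)) ∎
      cases (no _) (no _) (yes x∈e) = begin
        act a (act b (act a x)) ≡⟨ cong (act a ∘ act b) (act-away x∈e (e≢a , e≢b)) ⟩
        act a (act b x)         ≡⟨ cong (act a) (act-down x∈e) ⟩
        act a (P x)             ≡⟨ act-down (π-P x∈e) ⟩
        P (P x)                 ≡⟨ act-away (π-P (π-P x∈e)) (≢-sym b≢a , ≢-sym e≢a) ⟨
        act b (P (P x))         ≡⟨ cong (act b) (act-down (π-P x∈e)) ⟨
        act b (act a (P x))     ≡⟨ cong (act b ∘ act a) (act-down x∈e) ⟨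
        act b (act a (act b x)) ∎
      cases (no x∉a) (no x∉b) (no x∉e) = begin
        act a (act b (act a x)) ≡⟨ cong (act a ∘ act b) (act-away refl (x∉a , x∉b)) ⟩
        act a (act b x)         ≡⟨ cong (act a) (act-away refl (x∉b , x∉e)) ⟩
        act a x                 ≡⟨ act-away refl (x∉a , x∉b) ⟩
        x                       ≡⟨ act-away refl (x∉b , x∉e) ⟨
        act b x                 ≡⟨ cong (act b) (act-away refl (x∉a , x∉b)) ⟨
        act b (act a x)         ≡⟨ cong (act b ∘ act a) (act-away refl (x∉b , x∉e)) ⟨
        act b (act a (act b x)) ∎

  away-preserved : ∀ {i j} → i ≢ j → j ≢ nxt n i → i ≢ nxt n j →
                   ∀ x → Away j (π x) → Away j (π (act i x))
  away-preserved {i} {j} i≢j j≢i+1 i≢j+1 x away with π x F.≟ i | π x F.≟ nxt n i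
  ... | yes x∈i | _      = subst (Away j) (sym (π-S′ x∈i))
                              (≢-sym j≢i+1 , i≢j ∘ nxt-injective)
  ... | no _   | yes x∈i+1 = subst (Away j) (sym (π-P x∈i+1))
                              (i≢j , i≢j+1)
  ... | no x∉i | no x∉i+1 = away

  private
    comm-away : ∀ {i j} → i ≢ j → j ≢ nxt n i → i ≢ nxt n j →
                ∀ x → Away j (π x) → act i (act j x) ≡ act j (act i x)
    comm-away {i} {j} i≢j j≢i+1 i≢j+1 x away =
      trans (cong (act i) (act-away refl away))
            (sym (act-away refl (away-preserved i≢j j≢i+1 i≢j+1 x away)))

  -- For non-adjacent i, j a point lies away from the fibres of s_i or of s_j;
  -- on it one of the two acts trivially before and after the other.
  act-comm : ∀ i j → j ≢ nxt n i → i ≢ nxt n j → ∀ x → act i (act j x) ≡ act j (act i x)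
  act-comm i j j≢i+1 i≢j+1 x = cases (i F.≟ j) (π x F.≟ j) (π x F.≟ nxt n j)
    where
      cases : Dec (i ≡ j) → Dec (π x ≡ j) → Dec (π x ≡ nxt n j) → act i (act j x) ≡ act j (act i x)
      cases (yes refl) _ _ = refl
      cases (no i≢j) (no x∉j) (no x∉j+1) = comm-away i≢j j≢i+1 i≢j+1 x (x∉j , x∉j+1)
      cases (no i≢j) (yes x∈j) _ =
        sym (comm-away (≢-sym i≢j) i≢j+1 j≢i+1 x (subst (Away i) (sym x∈j) (≢-sym i≢j , j≢i+1)))
      cases (no i≢j) (no _) (yes x∈j+1) =
        sym (comm-away (≢-sym i≢j) i≢j+1 j≢i+1 x
                       (subst (Away i) (sym x∈j+1) (≢-sym i≢j+1 , i≢j ∘ nxt-injective ∘ sym)))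

  action : Action
  action = record { Point = X ; act = act ; act-sq = act-sq ; act-braid = act-braid ; act-comm = act-comm }

-- The affine action of S̃_n (n ≥ 3) on ℤ/2nℤ: the point (c , b) stands for
-- c + n·b, S adds one, and s_i exchanges i ↔ i + 1 and i + n ↔ i + n + 1.
module AffineAction (n : ℕ) .{{_ : NonZero n}} (3≤n : 3 ≤ n) where
  open Indices n
  open Runs n
  open Actions n

  Point : Set
  Point = Fin n × Bool

  crossing : Fin n → Bool
  crossing c = does (suc (toℕ c) ℕ.≟ n)

  S P : Point → Point
  S (c , b) = nxt n c , crossing c xor b
  P (c , b) = prv c , crossing (prv c) xor b

  private
    xor-cancel : ∀ a b → a xor (a xor b) ≡ b
    xor-cancel false b = refl
    xor-cancel true  b = not-involutive b

  S-P : ∀ x → S (P x) ≡ x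
  S-P (c , b) = cong₂ _,_ (nxt-prv c) (xor-cancel (crossing (prv c)) b)

  P-S : ∀ x → P (S x) ≡ x
  P-S (c , b) rewrite prv-nxt c = cong (c ,_) (xor-cancel (crossing c) b)

  open CyclicCover n 3≤n proj₁ S P (λ _ → refl) S-P P-S

  S-inner : ∀ {c} b → suc (toℕ c) < n → S (c , b) ≡ (nxt n c , b)
  S-inner {c} b lt = cong (λ a → nxt n c , a xor b) (dec-false (suc (toℕ c) ℕ.≟ n) (ℕ.<⇒≢ lt))

  S-wraps : ∀ {c} b → suc (toℕ c) ≡ n → S (c , b) ≡ (nxt n c , not b)
  S-wraps {c} b eq = cong (λ a → nxt n c , a xor b) (dec-true (suc (toℕ c) ℕ.≟ n) eq)

  -- The window (k, k + n] of ℤ/2nℤ; only s_k moves points across its ends.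
  Window : Fin n → Point → Set
  Window k (c , false) = toℕ k < toℕ c
  Window k (c , true)  = toℕ c ≤ toℕ k

  window-S : ∀ {k c} b → c ≢ k → Window k (c , b) → Window k (S (c , b))
  window-S {k} {c} b c≢k w with nxt-view c
  ... | inner lt v = subst (Window k) (sym (S-inner b lt)) (up b w)
    where
      up : ∀ b → Window k (c , b) → Window k (nxt n c , b)
      up false w = subst (toℕ k <_) (sym v) (ℕ.m≤n⇒m≤1+n w)
      up true  w = subst (_≤ toℕ k) (sym v) (≤∧≢⇒< w (c≢k ∘ toℕ-injective))
  ... | wraps eq v = subst (Window k) (sym (S-wraps b eq)) (up b w)
    where
      up : ∀ b → Window k (c , b) → Window k (nxt n c , not b)
      up false w = subst (_≤ toℕ k) (sym v) z≤n
      up true  w = ⊥-elim (c≢k (toℕ-injective (ℕ.≤-antisym w (ℕ.≤-pred (subst (toℕ k <_) (sym eq) (toℕ<n k))))))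

  window-S⁻¹ : ∀ {k c} b → c ≢ k → Window k (S (c , b)) → Window k (c , b)
  window-S⁻¹ {k} {c} b c≢k w with nxt-view c
  ... | inner lt v = down b (subst (Window k) (S-inner b lt) w)
    where
      down : ∀ b → Window k (nxt n c , b) → Window k (c , b)
      down false w = ≤∧≢⇒< (ℕ.≤-pred (subst (toℕ k <_) v w)) (c≢k ∘ toℕ-injective ∘ sym)
      down true  w = ≤-trans (ℕ.n≤1+n _) (subst (_≤ toℕ k) v w)
  ... | wraps eq v = down b (subst (Window k) (S-wraps b eq) w)
    where
      down : ∀ b → Window k (nxt n c , not b) → Window k (c , b)
      down false w = ≤∧≢⇒< (ℕ.≤-pred (subst (toℕ k <_) (sym eq) (toℕ<n k))) (c≢k ∘ toℕ-injective ∘ sym)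
      down true  w with () ← subst (toℕ k <_) v w

  window-preserved : ∀ {k} i x → i ≢ k → Window k x → Window k (act i x)
  window-preserved {k} i x@(c , b) i≢k w with c F.≟ i | c F.≟ nxt n i
  ... | yes c≡i | _ = window-S b (i≢k ∘ trans (sym c≡i)) w
  ... | no _ | yes c≡i+1 =
    window-S⁻¹ (proj₂ (P x)) (i≢k ∘ trans (sym (π-P {x} c≡i+1))) (subst (Window k) (sym (S-P x)) w)
  ... | no _ | no _ = w

  S-gen-inner : ∀ {j} b → suc j < n → S (gen n j , b) ≡ (gen n (suc j) , b)
  S-gen-inner {j} b lt =
    trans (S-inner b (subst (λ y → suc y < n) (sym (toℕ-gen (<⇒≤ lt))) lt)) (cong (_, b) (nxt-gen (<⇒≤ lt)))

  S-gen-wraps : ∀ {j} b → suc j ≡ n → S (gen n j , b) ≡ (gen n 0 , not b)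
  S-gen-wraps {j} b eq =
    trans (S-wraps b (trans (cong suc (toℕ-gen (subst (j <_) eq ≤-refl))) eq)) (cong (_, not b) (nxt-gen-last eq))

  step-down : ∀ {j} b → suc j < n → act (gen n j) (gen n (suc j) , b) ≡ (gen n j , b)
  step-down b lt = trans (cong (act _) (sym (S-gen-inner b lt))) (act-S refl)

  step-wraps : ∀ {j} b → suc j ≡ n → act (gen n j) (gen n 0 , b) ≡ (gen n j , not b)
  step-wraps b eq =
    trans (cong (act _) (sym (trans (S-gen-wraps (not b) eq) (cong (gen n 0 ,_) (not-involutive b)))))
          (act-S refl)

  descent-fixes : ∀ {k t} b → t ≤ k → suc k < n → run action (descent t) (gen n (suc k) , b) ≡ (gen n (suc k) , b)
  descent-fixes {k} {t} b t≤k k+1<n = run-fixed action (descent t) _ (All-descent t λ j j<t →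
    act-away refl (away-gen (ℕ.<-trans (≤-trans j<t t≤k) (<⇒≤ k+1<n)) k+1<n
                            (λ e → <-irrefl (sym e) (ℕ.m≤n⇒m≤1+n (≤-trans j<t t≤k)))
                            (λ _ e → <-irrefl (sym (ℕ.suc-injective e)) (≤-trans j<t t≤k))
                            (λ _ ())))

  descent-lowers : ∀ {k t} b → k < t → t < n → run action (descent t) (gen n (suc k) , b) ≡ (gen n k , b)
  descent-lowers {k} {suc t} b k<t+1 t+1<n with ℕ.m≤n⇒m<n∨m≡n (ℕ.≤-pred k<t+1)
  ... | inj₂ refl = trans (cong (act _) (descent-fixes b ≤-refl t+1<n)) (step-down b t+1<n)
  ... | inj₁ k<t = trans (cong (act _) (descent-lowers b k<t (<⇒≤ t+1<n)))
    (act-away refl (away-gen (<⇒≤ t+1<n) (ℕ.<-trans k<t (<⇒≤ t+1<n))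
                             (ℕ.<⇒≢ k<t) (λ _ → ℕ.<⇒≢ (ℕ.m<n⇒m<1+n k<t)) (λ eq → ⊥-elim (<-irrefl eq t+1<n))))

  ascent-wraps : ∀ {c} m b → c + suc m ≡ n → run action (ascent c (suc m)) (gen n 0 , b) ≡ (gen n c , not b)
  ascent-wraps {c} zero    b eq = step-wraps b (trans (ℕ.+-comm 1 c) eq)
  ascent-wraps {c} (suc m) b eq =
    trans (cong (act _) (ascent-wraps m b (trans (sym (ℕ.+-suc c (suc m))) eq))) (step-down (not b) c+1<n)
    where
      c+1<n : suc c < n
      c+1<n = subst (suc c <_) eq (subst (_≤ c + suc (suc m)) (ℕ.+-comm c 2) (ℕ.+-monoʳ-≤ c (s≤s (s≤s z≤n))))

  ascent-fixes : ∀ {x c} m b → 1 ≤ x → x < c → c + m ≤ n → run action (ascent c m) (gen n x , b) ≡ (gen n x , b)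
  ascent-fixes {x} {c} m b 1≤x x<c c+m≤n = run-fixed action (ascent c m) _ (All-ascent c m λ j c≤j j<c+m →
    act-away refl (away-gen (≤-trans j<c+m c+m≤n) (≤-trans x<c (≤-trans (ℕ.m≤m+n c m) c+m≤n))
                            (ℕ.<⇒≢ (≤-trans x<c c≤j))
                            (λ _ → ℕ.<⇒≢ (≤-trans x<c (ℕ.m≤n⇒m≤1+n c≤j)))
                            (λ _ e → <-irrefl (sym e) 1≤x)))

  -- r m moves a point of every window (k, k + n] out of it: for k = 0 the
  -- point 1 goes to c - n, for k ≥ c the point 1 + n goes to c, and for
  -- 0 < k < c the point k + 1 goes to k, where c = n - m.
  r-escapes : ∀ {m} → 0 < m → m < n → ∀ k → Σ Point λ x → Window k x × ¬ Window k (run action (r n m) x)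
  r-escapes {suc m′} _ m<n k = cases (toℕ k ℕ.≟ 0) (toℕ k ℕ.<? c)
    where
      m c : ℕ
      m = suc m′
      c = n ∸ m
      c+m≡n : c + m ≡ n
      c+m≡n = ℕ.m∸n+n≡m (<⇒≤ m<n)
      1≤c : 1 ≤ c
      1≤c = ℕ.m<n⇒0<n∸m m<n
      c<n : c < n
      c<n = subst (c <_) c+m≡n (ℕ.m<m+n c (s≤s z≤n))
      1<n : 1 < n
      1<n = <⇒≤ 3≤n
      run-r : ∀ x → run action (r n m) x ≡ run action (ascent c m) (run action (descent c) x)
      run-r x = trans (cong (λ w → run action w x) (r-split m)) (run-++ action (ascent c m) (descent c) x)
      moves-1 : ∀ b → run action (r n m) (gen n 1 , b) ≡ (gen n c , not b)
      moves-1 b = trans (run-r _)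
        (trans (cong (run action (ascent c m)) (descent-lowers b 1≤c c<n)) (ascent-wraps m′ b c+m≡n))
      cases : Dec (toℕ k ≡ 0) → Dec (toℕ k < c) → Σ Point λ x → Window k x × ¬ Window k (run action (r n m) x)
      cases (yes k≡0) _ = (gen n 1 , false) , subst₂ _<_ (sym k≡0) (sym (toℕ-gen 1<n)) (s≤s z≤n) ,
        λ w → ℕ.≤⇒≯ (subst₂ _≤_ (toℕ-gen c<n) k≡0 (subst (Window k) (moves-1 false) w)) 1≤c
      cases (no _) (no k≮c) = (gen n 1 , true) , subst (_≤ toℕ k) (sym (toℕ-gen 1<n)) (≤-trans 1≤c (ℕ.≮⇒≥ k≮c)) ,
        λ w → k≮c (subst (toℕ k <_) (toℕ-gen c<n) (subst (Window k) (moves-1 true) w))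
      cases (no k≢0) (yes k<c) = (gen n (suc (toℕ k)) , false) , subst (toℕ k <_) (sym (toℕ-gen k+1<n)) ≤-refl ,
        λ w → <-irrefl (sym (toℕ-gen (toℕ<n k))) (subst (Window k) moves-k+1 w)
        where
          k+1<n : suc (toℕ k) < n
          k+1<n = ℕ.≤-<-trans k<c c<n
          moves-k+1 : run action (r n m) (gen n (suc (toℕ k)) , false) ≡ (gen n (toℕ k) , false)
          moves-k+1 = trans (run-r _) (trans (cong (run action (ascent c m)) (descent-lowers false k<c c<n))
                        (ascent-fixes m false (ℕ.n≢0⇒n>0 k≢0) k<c (ℕ.≤-reflexive c+m≡n)))

  r-uses-every-letter : ∀ {m} → 0 < m → m < n → ∀ u → _≈_ n u (r n m) → ∀ k → k ∈ u
  r-uses-every-letter 0<m m<n u u≈r k with r-escapes 0<m m<n k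
  ... | x , inside , outside =
    letter-needed action (Window k) k (λ i x i≢k → window-preserved i x i≢k) x inside outside u u≈r

-- For n = 2 the braid relation makes the presented group the symmetric group
-- S₃, acting on three points by s₀ = (0 1), s₁ = (1 2); this stands in for
-- the affine action, which needs n ≥ 3.
module ThreePoints where
  open Actions 2

  pattern p₀ = F.zero
  pattern p₁ = F.suc F.zero
  pattern p₂ = F.suc (F.suc F.zero)

  act : Fin 2 → Fin 3 → Fin 3
  act p₀ p₀ = p₁
  act p₀ p₁ = p₀
  act p₀ p₂ = p₂
  act p₁ p₀ = p₀
  act p₁ p₁ = p₂
  act p₁ p₂ = p₁

  act-sq : ∀ i x → act i (act i x) ≡ x
  act-sq p₀ p₀ = refl
  act-sq p₀ p₁ = refl
  act-sq p₀ p₂ = refl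
  act-sq p₁ p₀ = refl
  act-sq p₁ p₁ = refl
  act-sq p₁ p₂ = refl

  act-braid : ∀ i x → act i (act (nxt 2 i) (act i x)) ≡ act (nxt 2 i) (act i (act (nxt 2 i) x))
  act-braid p₀ p₀ = refl
  act-braid p₀ p₁ = refl
  act-braid p₀ p₂ = refl
  act-braid p₁ p₀ = refl
  act-braid p₁ p₁ = refl
  act-braid p₁ p₂ = refl

  -- distinct generators are adjacent when n = 2, so only i = j remains
  act-comm : ∀ i j → j ≢ nxt 2 i → i ≢ nxt 2 j → ∀ x → act i (act j x) ≡ act j (act i x)
  act-comm p₀ p₀ _ _ x = refl
  act-comm p₁ p₁ _ _ x = refl
  act-comm p₀ p₁ j≢i+1 _ x = ⊥-elim (j≢i+1 refl)
  act-comm p₁ p₀ j≢i+1 _ x = ⊥-elim (j≢i+1 refl)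

  action : Action
  action = record { Point = Fin 3 ; act = act ; act-sq = act-sq ; act-braid = act-braid ; act-comm = act-comm }

  -- s₁ fixes the point 0, which r 1 = s₁ s₀ moves; s₀ fixes 2, which r 1 moves.
  r-uses-every-letter : ∀ u → _≈_ 2 u (r 2 1) → ∀ k → k ∈ u
  r-uses-every-letter u u≈r p₀ = letter-needed action (_≡ p₀) p₀ fixes-p₀ p₀ refl (λ ()) u u≈r
    where
      fixes-p₀ : ∀ i x → i ≢ p₀ → x ≡ p₀ → act i x ≡ p₀
      fixes-p₀ p₀ _ i≢p₀ _    = ⊥-elim (i≢p₀ refl)
      fixes-p₀ p₁ _ _    refl = refl
  r-uses-every-letter u u≈r p₁ = letter-needed action (_≡ p₂) p₁ fixes-p₂ p₂ refl (λ ()) u u≈r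
    where
      fixes-p₂ : ∀ i x → i ≢ p₁ → x ≡ p₂ → act i x ≡ p₂
      fixes-p₂ p₀ _ _    refl = refl
      fixes-p₂ p₁ _ i≢p₁ _    = ⊥-elim (i≢p₁ refl)

r-minimal : ∀ n .{{_ : NonZero n}} {m} → 0 < m → m < n → ∀ u → _≈_ n u (r n m) → n ≤ length u
r-minimal (suc zero) {suc m} _ (s≤s ()) u u≈r
r-minimal 2 {suc zero} _ _ u u≈r = covering-length u (ThreePoints.r-uses-every-letter u u≈r)
r-minimal 2 {suc (suc m)} _ (s≤s (s≤s ())) u u≈r
r-minimal n@(suc (suc (suc _))) 0<m m<n u u≈r =
  covering-length u (AffineAction.r-uses-every-letter n (s≤s (s≤s (s≤s z≤n))) 0<m m<n u u≈r)

-- With c = n - m we have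
-- r m = s_c ⋯ s_{n-1} · s_{c-1} ⋯ s_0, and s_j either cancels against the
-- first letter (j = c), braids into the ascent (j > c), or commutes past the
-- ascent and braids into the descent (j < c).
module Rewriting (n : ℕ) .{{_ : NonZero n}} where
  open Indices n
  open Runs n

  Has321 : Word n → Set
  Has321 W = ∃ λ p → ∃ λ q → ∃ λ i → W ≡ p ++ (i ∷ nxt n i ∷ i ∷ []) ++ q

  Has321Form : Word n → ℕ → Set
  Has321Form w L = Σ (Word n) λ W → _≈_ n w W × length W ≡ L × Has321 W

  ShorterThan : Word n → ℕ → Set
  ShorterThan w L = Σ (Word n) λ W → _≈_ n w W × length W < L

  ≡⇒≈ : ∀ {u v} → u ≡ v → _≈_ n u v
  ≡⇒≈ refl = ≈-refl

  321-≈ : ∀ {w w′ L} → _≈_ n w w′ → Has321Form w′ L → Has321Form w L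
  321-≈ e (W , e′ , l , h) = W , ≈-trans e e′ , l , h

  321-prefix : ∀ p {w L} → Has321Form w L → Has321Form (p ++ w) (length p + L)
  321-prefix p (W , e , l , (p′ , q , i , eq)) =
    p ++ W , ≈-++ ≈-refl e , trans (length-++ p) (cong (length p +_) l) ,
    (p ++ p′ , q , i , trans (cong (p ++_) eq) (sym (++-assoc p p′ _)))

  321-suffix : ∀ q {w L} → Has321Form w L → Has321Form (w ++ q) (L + length q)
  321-suffix q (W , e , l , (p , q′ , i , eq)) =
    W ++ q , ≈-++ e ≈-refl , trans (length-++ W) (cong (_+ length q) l) ,
    (p , q′ ++ q , i , trans (cong (_++ q) eq) (++-assoc p _ q))

  shorter-≈ : ∀ {w w′ L} → _≈_ n w w′ → ShorterThan w′ L → ShorterThan w L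
  shorter-≈ e (W , e′ , l) = W , ≈-trans e e′ , l

  shorter-prefix : ∀ p {w L} → ShorterThan w L → ShorterThan (p ++ w) (length p + L)
  shorter-prefix p (W , e , l) = p ++ W , ≈-++ ≈-refl e , subst (_< length p + _) (sym (length-++ p)) (ℕ.+-monoʳ-< (length p) l)

  commute-past : ∀ j L → All (Commuting j) L → _≈_ n (j ∷ L) (L ++ [ j ])
  commute-past j []      []       = ≈-refl
  commute-past j (i ∷ L) (c ∷ cs) =
    ≈-trans (≈-++ {u = j ∷ i ∷ []} {u′ = i ∷ j ∷ []} {v = L} (rel-comm j i (proj₁ c) (proj₂ c)) ≈-refl)
            (≈-++ {u = i ∷ []} ≈-refl (commute-past j L cs))

  private
    swap : ∀ {i j} → Commuting i j → _≈_ n (j ∷ i ∷ []) (i ∷ j ∷ [])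
    swap {i} {j} c = rel-comm j i (proj₂ c) (proj₁ c)

  -- s_{c+d+1} · s_c ⋯ s_{c+m-1} for d + 1 < m: move s_{c+d+1} down to the
  -- factor s_{c+d} s_{c+d+1} and braid.
  braid-into-ascent : ∀ d c m → 1 ≤ c → c + m ≤ n → suc d < m →
                      Has321Form (gen n (c + suc d) ∷ ascent c m) (suc m)
  braid-into-ascent zero c (suc zero) _ _ (s≤s ())
  braid-into-ascent zero c (suc (suc m)) 1≤c c+m≤n _ =
    subst (λ w → Has321Form w (3 + m)) (sym word)
      (i ∷ nxt n i ∷ i ∷ rest , ≈-++ {u = nxt n i ∷ i ∷ nxt n i ∷ []} (≈-sym (rel-braid i)) ≈-refl ,
       cong (λ l → suc (suc (suc l))) (length-ascent (suc (suc c)) m) , ([] , rest , i , refl))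
    where
      i : Fin n
      i = gen n c
      rest : Word n
      rest = ascent (suc (suc c)) m
      c+1<n : suc c < n
      c+1<n = ≤-trans (subst (_≤ c + suc (suc m)) (ℕ.+-comm c 2) (ℕ.+-monoʳ-≤ c (s≤s (s≤s z≤n)))) c+m≤n
      c+1 : gen n (c + 1) ≡ nxt n i
      c+1 = trans (cong (gen n) (ℕ.+-comm c 1)) (sym (nxt-gen (<⇒≤ c+1<n)))
      word : gen n (c + 1) ∷ ascent c (suc (suc m)) ≡ nxt n i ∷ i ∷ nxt n i ∷ rest
      word = cong₂ _∷_ c+1 (cong (i ∷_) (cong (_∷ rest) (sym (nxt-gen (<⇒≤ c+1<n)))))
  braid-into-ascent (suc d) c (suc m) 1≤c c+m≤n (s≤s d+1<m) =
    321-≈ (≈-++ {u = y ∷ gen n c ∷ []} (swap commutes) ≈-refl)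
      (321-prefix [ gen n c ] (subst (λ w → Has321Form (gen n w ∷ ascent (suc c) m) (suc m)) (sym (ℕ.+-suc c (suc d)))
         (braid-into-ascent d (suc c) m (ℕ.m≤n⇒m≤1+n 1≤c) (subst (_≤ n) (ℕ.+-suc c m) c+m≤n) d+1<m)))
    where
      y : Fin n
      y = gen n (c + suc (suc d))
      commutes : Commuting (gen n c) y
      commutes = commuting-gen (subst (_≤ c + suc (suc d)) (ℕ.+-comm c 2) (ℕ.+-monoʳ-≤ c (s≤s (s≤s z≤n))))
                               (≤-trans (ℕ.+-monoʳ-< c (s≤s d+1<m)) c+m≤n) (inj₂ 1≤c)

  -- s_t · s_{t+e+1} ⋯ s_0: move s_t down to the factor s_t s_{t+1} s_t
  braid-into-descent : ∀ t e → suc (suc (t + e)) < n →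
                       Has321Form (gen n t ∷ descent (suc (suc (t + e)))) (suc (suc (suc (t + e))))
  braid-into-descent t zero t+2<n rewrite ℕ.+-identityʳ t =
    subst (λ s → Has321Form (gen n t ∷ s ∷ gen n t ∷ descent t) (3 + t)) (nxt-gen (<⇒≤ (<⇒≤ t+2<n)))
      (W , ≈-refl , cong (λ l → suc (suc (suc l))) (length-descent t) , ([] , descent t , gen n t , refl))
    where
      W : Word n
      W = gen n t ∷ nxt n (gen n t) ∷ gen n t ∷ descent t
  braid-into-descent t (suc e) s<n rewrite ℕ.+-suc t e =
    321-≈ (≈-++ {u = gen n t ∷ gen n s ∷ []} (≈-sym (swap commutes)) ≈-refl)
      (321-prefix [ gen n s ] (braid-into-descent t e (<⇒≤ s<n)))
    where
      s : ℕ
      s = suc (suc (t + e))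
      commutes : Commuting (gen n t) (gen n s)
      commutes = commuting-gen (s≤s (s≤s (ℕ.m≤m+n t e))) (<⇒≤ s<n) (inj₁ s<n)

  private
    commutes-with-ascent : ∀ {t} c m → 1 ≤ t → suc (suc t) ≤ c → c + m ≤ n → All (Commuting (gen n t)) (ascent c m)
    commutes-with-ascent c m 1≤t t+2≤c c+m≤n =
      All-ascent c m λ y c≤y y<c+m → commuting-gen (≤-trans t+2≤c c≤y) (≤-trans y<c+m c+m≤n) (inj₂ 1≤t)

  below-ascent : ∀ t e m → 1 ≤ t → suc (suc (t + e)) + m ≡ n → suc (suc (t + e)) < n →
                 Has321Form (gen n t ∷ (ascent (suc (suc (t + e))) m ++ descent (suc (suc (t + e))))) (suc n)
  below-ascent t e m 1≤t c+m≡n c<n =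
    321-≈ (≈-++ {u = gen n t ∷ ascent c m} (commute-past (gen n t) (ascent c m)
                  (commutes-with-ascent c m 1≤t (s≤s (s≤s (ℕ.m≤m+n t e))) (ℕ.≤-reflexive c+m≡n))) ≈-refl)
      (subst (Has321Form _) total
        (subst (λ w → Has321Form w (length (ascent c m) + suc c)) (sym (++-assoc (ascent c m) [ gen n t ] (descent c)))
          (321-prefix (ascent c m) (braid-into-descent t e c<n))))
    where
      c : ℕ
      c = suc (suc (t + e))
      total : length (ascent c m) + suc c ≡ suc n
      total = begin
        length (ascent c m) + suc c ≡⟨ cong (_+ suc c) (length-ascent c m) ⟩
        m + suc c                   ≡⟨ ℕ.+-suc m c ⟩
        suc (m + c)                 ≡⟨ cong suc (trans (ℕ.+-comm m c) c+m≡n) ⟩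
        suc n                       ∎
        where open ≡-Reasoning

  -- j = c - 1: the second s_{c-1} commutes leftwards past s_{c+1} ⋯ s_{n-1}
  -- and completes s_{c-1} s_c s_{c-1}
  just-below-ascent : ∀ t m → 1 ≤ t → suc t + suc m ≡ n →
                      Has321Form (gen n t ∷ (ascent (suc t) (suc m) ++ descent (suc t))) (suc n)
  just-below-ascent t m 1≤t c+m≡n =
    321-≈ (≈-++ {u = gen n t ∷ gen n (suc t) ∷ []} ≈-refl
             (≈-trans (≡⇒≈ (sym (++-assoc A [ gen n t ] (descent t))))
                      (≈-++ {u = A ++ [ gen n t ]} (≈-sym (commute-past (gen n t) A
                              (commutes-with-ascent (suc (suc t)) m 1≤t ≤-refl c+m≤n))) ≈-refl)))
      (W , ≈-refl , total , ([] , A ++ descent t , gen n t , cong (λ s → gen n t ∷ s ∷ gen n t ∷ A ++ descent t) (sym (nxt-gen t<n))))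
    where
      A W : Word n
      A = ascent (suc (suc t)) m
      W = gen n t ∷ gen n (suc t) ∷ gen n t ∷ A ++ descent t
      c+m≤n : suc (suc t) + m ≤ n
      c+m≤n = ℕ.≤-reflexive (trans (sym (ℕ.+-suc (suc t) m)) c+m≡n)
      t<n : t < n
      t<n = subst (t <_) c+m≡n (ℕ.<-≤-trans (ℕ.n<1+n t) (ℕ.m≤m+n (suc t) (suc m)))
      total : length W ≡ suc n
      total = begin
        3 + length (A ++ descent t)           ≡⟨ cong (3 +_) (length-++ A) ⟩
        3 + (length A + length (descent t))   ≡⟨ cong (3 +_) (cong₂ _+_ (length-ascent _ m) (length-descent t)) ⟩
        3 + (m + t)                           ≡⟨ cong (λ k → suc (suc k)) (trans (cong suc (ℕ.+-comm m t)) (sym (ℕ.+-suc t m))) ⟩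
        suc (suc t + suc m)                   ≡⟨ cong suc c+m≡n ⟩
        suc n                                 ∎
        where open ≡-Reasoning

  at-ascent : ∀ c m → c + suc m ≡ n → ShorterThan (gen n c ∷ (ascent c (suc m) ++ descent c)) n
  at-ascent c m c+m≡n = rest , ≈-++ {u = gen n c ∷ gen n c ∷ []} {u′ = []} (rel-sq (gen n c)) ≈-refl , shorter
    where
      rest : Word n
      rest = ascent (suc c) m ++ descent c
      shorter : length rest < n
      shorter = begin-strict
        length rest                                      ≡⟨ length-++ (ascent (suc c) m) ⟩
        length (ascent (suc c) m) + length (descent c)   ≡⟨ cong₂ _+_ (length-ascent _ m) (length-descent c) ⟩
        m + c                                            ≡⟨ ℕ.+-comm m c ⟩
        c + m                                            <⟨ ℕ.+-monoʳ-< c (ℕ.n<1+n m) ⟩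
        c + suc m                                        ≡⟨ c+m≡n ⟩
        n                                                ∎
        where open ℕ.≤-Reasoning

  inside-ascent : ∀ c d m → 1 ≤ c → c + m ≡ n → c + suc d < n →
                  Has321Form (gen n (c + suc d) ∷ (ascent c m ++ descent c)) (suc n)
  inside-ascent c d m 1≤c c+m≡n j<n =
    subst (Has321Form _) total
      (321-suffix (descent c) (braid-into-ascent d c m 1≤c (ℕ.≤-reflexive c+m≡n)
                                 (ℕ.+-cancelˡ-< c (suc d) m (subst (c + suc d <_) (sym c+m≡n) j<n))))
    where
      total : suc m + length (descent c) ≡ suc n
      total = cong suc (trans (cong (m +_) (length-descent c)) (trans (ℕ.+-comm m c) c+m≡n))

  extend-r : ∀ {m} → 0 < m → m < n → ∀ j → toℕ j ≢ 0 →
             Has321Form (j ∷ r n m) (suc n) ⊎ ShorterThan (j ∷ r n m) n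
  extend-r {m@(suc m′)} _ m<n j j≢0 =
    subst Outcome (cong₂ _∷_ (gen-toℕ j) (sym (r-split m))) (cases (ℕ.<-cmp t c))
    where
      t c : ℕ
      t = toℕ j
      c = n ∸ m
      c+m≡n : c + m ≡ n
      c+m≡n = ℕ.m∸n+n≡m (<⇒≤ m<n)
      1≤t : 1 ≤ t
      1≤t = ℕ.n≢0⇒n>0 j≢0
      Outcome : Word n → Set
      Outcome w = Has321Form w (suc n) ⊎ ShorterThan w n
      prepend : ℕ → ℕ → Word n
      prepend t c = gen n t ∷ (ascent c m ++ descent c)
      cases : Tri (t < c) (t ≡ c) (c < t) → Outcome (prepend t c)
      cases (tri< t<c _ _) with ℕ.m≤n⇒m<n∨m≡n t<c
      ... | inj₂ t+1≡c = inj₁ (subst (λ c → Has321Form (prepend t c) (suc n)) t+1≡c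
                                (just-below-ascent t m′ 1≤t (trans (cong (_+ m) t+1≡c) c+m≡n)))
      ... | inj₁ t+2≤c = inj₁ (subst (λ c → Has321Form (prepend t c) (suc n)) t+2+e≡c
                                (below-ascent t e m 1≤t (trans (cong (_+ m) t+2+e≡c) c+m≡n)
                                                     (subst (_< n) (sym t+2+e≡c) c<n)))
        where
          e : ℕ
          e = c ∸ suc (suc t)
          t+2+e≡c : suc (suc t) + e ≡ c
          t+2+e≡c = ℕ.m+[n∸m]≡n t+2≤c
          c<n : c < n
          c<n = subst (c <_) c+m≡n (ℕ.m<m+n c (s≤s z≤n))
      cases (tri≈ _ t≡c _) = inj₂ (subst (λ t → ShorterThan (prepend t c) n) (sym t≡c) (at-ascent c m′ c+m≡n))
      cases (tri> _ _ c<t) = inj₁ (subst (λ t → Has321Form (prepend t c) (suc n)) c+d+1≡t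
                               (inside-ascent c d m (ℕ.m<n⇒0<n∸m m<n) c+m≡n (subst (_< n) (sym c+d+1≡t) (toℕ<n j))))
        where
          d : ℕ
          d = t ∸ suc c
          c+d+1≡t : c + suc d ≡ t
          c+d+1≡t = trans (ℕ.+-suc c d) (ℕ.m+[n∸m]≡n c<t)

module Lengths (n : ℕ) .{{_ : NonZero n}} where
  open Rewriting n

  length-minimal : ∀ {w a} → HasLength n w a → ∀ u → _≈_ n u w → a ≤ length u
  length-minimal (_ , (_ , minimal) , len) u u≈w = subst (_≤ length u) len (minimal u u≈w)

  reduced-length : ∀ {u w a} → IsReduced n u w → HasLength n w a → length u ≡ a
  reduced-length {u} (u≈w , u-minimal) ℓw@(u′ , (u′≈w , _) , len) =
    ℕ.≤-antisym (subst (length u ≤_) len (u-minimal u′ u′≈w)) (length-minimal ℓw u u≈w)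

  reduced-of-length : ∀ {w a} → HasLength n w a → ∀ u → _≈_ n u w → length u ≡ a → IsReduced n u w
  reduced-of-length ℓw u u≈w len = u≈w , λ u′ u′≈w → subst (_≤ length u′) (sym len) (length-minimal ℓw u′ u′≈w)

  no-321-form : ∀ {w a} → Avoids321 n w → HasLength n w a → ¬ Has321Form w a
  no-321-form avoids ℓw (W , w≈W , len , has321) = avoids W (reduced-of-length ℓw W (≈-sym w≈W) len) has321

  no-shorter : ∀ {w a L} → HasLength n w a → L ≤ a → ¬ ShorterThan w L
  no-shorter ℓw L≤a (W , w≈W , shorter) = ℕ.<⇒≱ (ℕ.<-≤-trans shorter L≤a) (length-minimal ℓw W (≈-sym w≈W))

  ℓ-r : ∀ {m b} → 0 < m → m < n → HasLength n (r n m) b → b ≡ n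
  ℓ-r {m} 0<m m<n ℓr@(u , (u≈r , _) , len) =
    ℕ.≤-antisym (subst (_ ≤_) (Runs.length-r n (<⇒≤ m<n)) (length-minimal ℓr (r n m) ≈-refl))
                (subst (n ≤_) len (r-minimal n 0<m m<n u u≈r))

last-letter-is-s₀ : ∀ n .{{_ : NonZero n}} {m} → 0 < m → m < n →
                    ∀ {v a} → Avoids321 n (v ++ r n m) → HasLength n v a → HasLength n (v ++ r n m) (a + n) →
                    ∀ u′ j → IsReduced n (u′ ++ [ j ]) v → j ≡ gen n 0
last-letter-is-s₀ n {m} 0<m m<n {v} {a} avoids ℓv ℓvr u′ j u-red = decide (j F.≟ gen n 0)
  where
    open Indices n
    open Rewriting n
    open Lengths n
    split : _≈_ n (v ++ r n m) (u′ ++ (j ∷ r n m))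
    split = ≈-sym (≈-trans (≡⇒≈ (sym (++-assoc u′ [ j ] (r n m)))) (≈-++ (proj₁ u-red) ≈-refl))
    ℓu : length u′ + 1 ≡ a
    ℓu = trans (sym (length-++ u′)) (reduced-length u-red ℓv)
    long-length : length u′ + suc n ≡ a + n
    long-length = trans (sym (ℕ.+-assoc (length u′) 1 n)) (cong (_+ n) ℓu)
    short-bound : length u′ + n ≤ a + n
    short-bound = ℕ.+-monoˡ-≤ n (subst (length u′ ≤_) ℓu (ℕ.m≤m+n (length u′) 1))
    impossible : Has321Form (j ∷ r n m) (suc n) ⊎ ShorterThan (j ∷ r n m) n → ⊥
    impossible (inj₁ long)  =
      no-321-form avoids ℓvr (subst (Has321Form _) long-length (321-≈ split (321-prefix u′ long)))
    impossible (inj₂ short) = no-shorter ℓvr short-bound (shorter-≈ split (shorter-prefix u′ short))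
    decide : Dec (j ≡ gen n 0) → j ≡ gen n 0
    decide (yes j≡s₀) = j≡s₀
    decide (no  j≢s₀) = ⊥-elim (impossible (extend-r 0<m m<n j (j≢s₀ ∘ toℕ≡0)))

lemma6 : (n m : ℕ) .{{_ : NonZero n}} → 0 < m → m < n → (v : Word n) →
         Avoids321 n (v ++ r n m) →
         (∃ λ a → ∃ λ b → HasLength n v a × HasLength n (r n m) b × HasLength n (v ++ r n m) (a + b)) →
         ZeroGrassmannian n v
lemma6 n m 0<m m<n v avoids (a , b , ℓv , ℓr , ℓvr) u u-red u≢[] with initLast u
... | []       = ⊥-elim (u≢[] refl)
... | u′ ∷ʳ′ j = u′ , cong (λ k → u′ ++ [ k ]) (last-letter-is-s₀ n 0<m m<n avoids ℓv ℓvr′ u′ j u-red)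
  where
    ℓvr′ : HasLength n (v ++ r n m) (a + n)
    ℓvr′ = subst (HasLength n (v ++ r n m)) (cong (a +_) (Lengths.ℓ-r n 0<m m<n ℓr)) ℓvr
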